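{- Let $\langle\mathbb{S},\to\rangle$ be a total transition system and $M=\mathscr{M}_\to$. For every $S\subseteq\mathbb{S}$, $\gamma^\forall_M(S)$ is not a fixpoint of the complete core $\mathrm{core}_{\oplus}(\rho^\forall_M)$ if and only if there exist $k>0$, $q\in S$, $r\in\mathbb{S}\setminus S$ and $t\in\mathbb{S}$ such that $q\xrightarrow{k}t$ and $r\xrightarrow{k}t$.
   Context: $\mathbb{T}$ is the set of traces $\langle i,\sigma\rangle$, $i\in\mathbb{Z}$, $\sigma:\mathbb{Z}\to\mathbb{S}$; $X_{\downarrow s}=\{\langle i,\sigma\rangle\in X\mid\sigma_i=s\}$; $\oplus(X)=\{\langle i,\sigma\rangle\mid\langle i+1,\sigma\rangle\in X\}$. A total transition system $\langle\mathbb{S},\to\rangle$: $\to\subseteq\mathbb{S}\times\mathbb{S}$, every state has a successor and a predecessor; $\mathscr{M}_\to=\{\langle i,\sigma\rangle\mid\forall k\in\mathbb{Z}.\ \sigma_k\to\sigma_{k+1}\}$. For $k>0$, $r\xrightarrow{k}s$ means there are $r_0=r,r_1,\dots,r_k=s$ with $r_j\to r_{j+1}$ for all $j<k$. $\gamma^\forall_M(S)=\{\langle i,\sigma\rangle\in M\mid\sigma_i\in S\}$; $\rho^\forall_M(X)=\{\langle i,\sigma\rangle\in M\mid M_{\downarrow\sigma_i}\subseteq X\}$. Upper closure operators on $\langle\wp(\mathbb{T}),\supseteq\rangle$: maps monotone w.r.t. $\subseteq$, idempotent, with $\rho(X)\subseteq X$; $\rho\sqsubseteq\eta$ iff $\rho(X)\supseteq\eta(X)$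 for all $X$. $\eta$ is complete for $\oplus$ if $\eta\circ\oplus=\eta\circ\oplus\circ\eta$. $\mathrm{core}_{\oplus}(\rho^\forall_M)$ is the $\sqsubseteq$-least closure $\eta$ with $\rho^\forall_M\sqsubseteq\eta$ that is complete for $\oplus$. -}

module Defs where

open import Level using (0ℓ)
open import Data.Nat using (ℕ; zero; suc)
open import Data.Integer using (ℤ; _+_; 1ℤ)
open import Data.Product using (Σ; _×_; _,_; ∃)
open import Relation.Binary.PropositionalEquality using (_≡_)
open import Relation.Unary using (Pred; _⊆_; _∈_)

Trace : Set → Set
Trace 𝕊 = ℤ × (ℤ → 𝕊)

TSet : Set → Set₁
TSet 𝕊 = Pred (Trace 𝕊) 0ℓ

cur : {𝕊 : Set} → Trace 𝕊 → 𝕊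
cur (i , σ) = σ i

_≐_ : {𝕊 : Set} → TSet 𝕊 → TSet 𝕊 → Set
X ≐ Y = (X ⊆ Y) × (Y ⊆ X)

⊕ : {𝕊 : Set} → TSet 𝕊 → TSet 𝕊
⊕ X (i , σ) = X (i + 1ℤ , σ)

IsTotal : {𝕊 : Set} → (𝕊 → 𝕊 → Set) → Set
IsTotal {𝕊} _⟶_ = (∀ s → ∃ λ t → s ⟶ t) × (∀ s → ∃ λ r → r ⟶ s)

𝓜 : {𝕊 : Set} → (𝕊 → 𝕊 → Set) → TSet 𝕊
𝓜 _⟶_ (i , σ) = ∀ k → σ k ⟶ σ (k + 1ℤ)

Reach : {𝕊 : Set} → (𝕊 → 𝕊 → Set) → ℕ → 𝕊 → 𝕊 → Set
Reach _⟶_ zero    r s = r ≡ s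
Reach _⟶_ (suc k) r s = Σ _ λ r₁ → (r ⟶ r₁) × Reach _⟶_ k r₁ s

γ∀ : {𝕊 : Set} → TSet 𝕊 → Pred 𝕊 0ℓ → TSet 𝕊
γ∀ M S t = M t × S (cur t)

-- ρ^∀_M(X) = {⟨i,σ⟩ ∈ M | M_{↓σ_i} ⊆ X}
ρ∀ : {𝕊 : Set} → TSet 𝕊 → TSet 𝕊 → TSet 𝕊
ρ∀ M X t = M t × (∀ t′ → M t′ → cur t′ ≡ cur t → X t′)

-- Upper closure operators on ⟨℘(𝕋), ⊇⟩.
record IsUCO {𝕊 : Set} (η : TSet 𝕊 → TSet 𝕊) : Set₁ where
  field
    monotone   : ∀ {X Y} → X ⊆ Y → η X ⊆ η Y
    idempotent : ∀ X → η (η X) ≐ η X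
    reductive  : ∀ X → η X ⊆ X

_⊑_ : {𝕊 : Set} → (TSet 𝕊 → TSet 𝕊) → (TSet 𝕊 → TSet 𝕊) → Set₁
ρ ⊑ η = ∀ X → η X ⊆ ρ X

CompleteFor⊕ : {𝕊 : Set} → (TSet 𝕊 → TSet 𝕊) → Set₁
CompleteFor⊕ η = ∀ X → η (⊕ X) ≐ η (⊕ (η X))

record IsCore⊕ {𝕊 : Set} (ρ η : TSet 𝕊 → TSet 𝕊) : Set₂ where
  field
    uco      : IsUCO η
    above    : ρ ⊑ η
    complete : CompleteFor⊕ η
    least    : ∀ η′ → IsUCO η′ → ρ ⊑ η′ → CompleteFor⊕ η′ → η ⊑ η′

{-# OPTIONS --safe #-}
-- Let states be linked when a chain of pairs connects them, each pair reaching a common state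
-- after the same number of steps. The operator X ↦ {a ∈ M | every b ∈ M whose state is linked
-- to that of a lies in X} is an upper closure above ρ∀_M and complete for ⊕, hence lies above
-- the core; so γ∀_M(S) is a fixpoint whenever S is closed under linking, which by excluded
-- middle holds when no q ∈ S and r ∉ S meet after k > 0 steps. Conversely, if η is complete
-- for ⊕ and Y is η-closed, so is the set ⊖ Y with ⊕ (⊖ Y) = Y; by induction on k an η-closed
-- set containing a trace then contains every M-trace agreeing with it after k steps, the case
-- k = 0 being η ⊑ ρ∀_M. Extending q →ᵏ t and r →ᵏ t to traces by totality shows that γ∀_M(S)
-- is not η-closed when q ∈ S and r ∉ S.
module Submission where

open import Defs
open import Level using (0ℓ)
open import Axiom.ExcludedMiddle using (ExcludedMiddle)
open import Data.Nat using (ℕ; zero; suc; _<_; z<s)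
import Data.Nat.Properties as ℕ
open import Data.Integer using (ℤ; 0ℤ; 1ℤ; +_; -[1+_]; _+_; _-_; -_)
import Data.Integer.Properties as ℤ
open import Data.Product using (Σ; _×_; _,_; proj₁; proj₂)
open import Relation.Nullary using (¬_)
open import Relation.Nullary.Decidable using (decidable-stable)
open import Relation.Unary using (Pred; _⊆_)
open import Relation.Binary.PropositionalEquality using (_≡_; refl; sym; trans; cong; subst)
open import Relation.Binary.Construct.Closure.ReflexiveTransitive using (Star; ε; _◅_; _◅◅_)
open import Function.Bundles using (_⇔_; mk⇔)

module _ {𝕊 : Set} where

  next : Trace 𝕊 → Trace 𝕊
  next (i , σ) = (i + 1ℤ , σ)

  prev : Trace 𝕊 → Trace 𝕊
  prev (i , σ) = (i - 1ℤ , σ)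

  next^ : ℕ → Trace 𝕊 → Trace 𝕊
  next^ zero    a = a
  next^ (suc k) a = next^ k (next a)

  next-prev : ∀ a → next (prev a) ≡ a
  next-prev (i , σ) = cong (_, σ) (trans (ℤ.+-assoc i (- 1ℤ) 1ℤ) (ℤ.+-identityʳ i))

  prev-next : ∀ a → prev (next a) ≡ a
  prev-next (i , σ) = cong (_, σ) (trans (ℤ.+-assoc i 1ℤ (- 1ℤ)) (ℤ.+-identityʳ i))

  cur-next^ : ∀ k i (σ : ℤ → 𝕊) → cur (next^ k (i , σ)) ≡ σ (i + + k)
  cur-next^ zero    i σ = cong σ (sym (ℤ.+-identityʳ i))
  cur-next^ (suc k) i σ = trans (cur-next^ k (i + 1ℤ) σ) (cong σ (ℤ.+-assoc i 1ℤ (+ k)))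

module _ {𝕊 : Set} (_⟶_ : 𝕊 → 𝕊 → Set) where

  private
    M : TSet 𝕊
    M = 𝓜 _⟶_

  𝓜-next^ : ∀ k {a} → M a → M (next^ k a)
  𝓜-next^ zero    m = m
  𝓜-next^ (suc k) m = 𝓜-next^ k m

  Meet : 𝕊 → 𝕊 → Set
  Meet q r = Σ ℕ λ k → Σ 𝕊 λ t → Reach _⟶_ k q t × Reach _⟶_ k r t

  Linked : 𝕊 → 𝕊 → Set
  Linked = Star Meet

  Meet-reflexive : ∀ {q r} → q ≡ r → Meet q r
  Meet-reflexive {q} q≡r = 0 , q , refl , sym q≡r

  Meet-predecessors : ∀ {q q′ r r′} → q ⟶ q′ → r ⟶ r′ → Meet q′ r′ → Meet q r
  Meet-predecessors q⟶q′ r⟶r′ (k , t , q′↝t , r′↝t) =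
    suc k , t , (_ , q⟶q′ , q′↝t) , (_ , r⟶r′ , r′↝t)

  Linked-predecessors : IsTotal _⟶_ →
    ∀ {q q′ r r′} → q ⟶ q′ → r ⟶ r′ → Linked q′ r′ → Linked q r
  Linked-predecessors total q⟶q′ r⟶q′ ε = Meet-predecessors q⟶q′ r⟶q′ (Meet-reflexive refl) ◅ ε
  Linked-predecessors total q⟶q′ r⟶r′ (_◅_ {j = s′} q′⋈s′ s′~r′) =
    let s , s⟶s′ = proj₂ total s′
    in Meet-predecessors q⟶q′ s⟶s′ q′⋈s′ ◅ Linked-predecessors total s⟶s′ r⟶r′ s′~r′

  linkedClosure : TSet 𝕊 → TSet 𝕊
  linkedClosure X a = M a × (∀ b → M b → Linked (cur a) (cur b) → X b)

  linkedClosure-isUCO : IsUCO linkedClosure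
  linkedClosure-isUCO = record
    { monotone   = λ X⊆Y (m , f) → m , λ b mb a~b → X⊆Y (f b mb a~b)
    ; idempotent = λ X → (λ (m , f) → m , λ b mb a~b → proj₂ (f b mb a~b) b mb ε)
                       , (λ (m , f) → m , λ b mb a~b → mb , λ c mc b~c → f c mc (a~b ◅◅ b~c))
    ; reductive  = λ X {a} (m , f) → f a m ε
    }

  ρ∀⊑linkedClosure : ρ∀ M ⊑ linkedClosure
  ρ∀⊑linkedClosure X (m , f) = m , λ b mb b≡a → f b mb (Meet-reflexive (sym b≡a) ◅ ε)

  linkedClosure-complete : IsTotal _⟶_ → CompleteFor⊕ linkedClosure
  linkedClosure-complete total X =
    shift-inside , λ (m , f) → m , λ b mb a~b → proj₂ (f b mb a~b) (next b) mb ε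
    where
    shift-inside : linkedClosure (⊕ X) ⊆ linkedClosure (⊕ (linkedClosure X))
    shift-inside (m , f) = m , λ b@(i , _) mb a~b → mb , λ c@(j , _) mc nb~c →
      let prev-c⟶c = subst (λ d → cur (prev c) ⟶ cur d) (next-prev c) (mc (j - 1ℤ))
          a~prev-c = a~b ◅◅ Linked-predecessors total (mb i) prev-c⟶c nb~c
      in subst X (next-prev c) (f (prev c) mc a~prev-c)

  module _ (total : IsTotal _⟶_) where

    private
      successor predecessor : 𝕊 → 𝕊
      successor   s = proj₁ (proj₁ total s)
      predecessor s = proj₁ (proj₂ total s)

      follow : ∀ {k q t} → Reach _⟶_ k q t → ℕ → 𝕊
      follow {q = q} _           zero    = q
      follow {zero}  q≡t         (suc n) = successor (follow q≡t n)
      follow {suc k} (_ , _ , p) (suc n) = follow p n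

      follow-step : ∀ {k q t} (p : Reach _⟶_ k q t) n → follow p n ⟶ follow p (suc n)
      follow-step {zero}  q≡t            n       = proj₂ (proj₁ total (follow q≡t n))
      follow-step {suc k} (_ , q⟶q₁ , _) zero    = q⟶q₁
      follow-step {suc k} (_ , _ , p)    (suc n) = follow-step p n

      follow-end : ∀ {k q t} (p : Reach _⟶_ k q t) → follow p k ≡ t
      follow-end {zero}  q≡t         = q≡t
      follow-end {suc k} (_ , _ , p) = follow-end p

      before : 𝕊 → ℕ → 𝕊
      before s zero    = predecessor s
      before s (suc n) = predecessor (before s n)

      pathState : ∀ {k q t} → Reach _⟶_ k q t → ℤ → 𝕊
      pathState p         (+ n)    = follow p n
      pathState {q = q} _ -[1+ n ] = before q n

      pathState-𝓜 : ∀ {k q t} (p : Reach _⟶_ k q t) → M (0ℤ , pathState p)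
      pathState-𝓜 p         (+ n)        =
        subst (λ m → follow p n ⟶ follow p m) (ℕ.+-comm 1 n) (follow-step p n)
      pathState-𝓜 {q = q} _ -[1+ zero ]  = proj₂ (proj₂ total q)
      pathState-𝓜 {q = q} _ -[1+ suc n ] = proj₂ (proj₂ total (before q n))

    Reach⇒𝓜-trace : ∀ {k q t} → Reach _⟶_ k q t →
      Σ (Trace 𝕊) λ a → M a × cur a ≡ q × cur (next^ k a) ≡ t
    Reach⇒𝓜-trace {k} p =
      (0ℤ , pathState p) , pathState-𝓜 p , refl , trans (cur-next^ k 0ℤ (pathState p)) (follow-end p)

module _ {𝕊 : Set} {M : TSet 𝕊} {η : TSet 𝕊 → TSet 𝕊}
         (uco : IsUCO η) (ρ∀⊑η : ρ∀ M ⊑ η) (complete : CompleteFor⊕ η) where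

  open IsUCO uco

  ⊖ : TSet 𝕊 → TSet 𝕊
  ⊖ Y a = Y (prev a)

  ⊖-closed : ∀ {Y} → Y ⊆ η Y → ⊖ Y ⊆ η (⊖ Y)
  ⊖-closed {Y} Y-closed {a} y =
    subst (η (⊖ Y)) (next-prev a)
      (reductive (⊕ (η (⊖ Y))) (proj₁ (complete (⊖ Y)) (monotone Y⊆⊕⊖Y (Y-closed y))))
    where
    Y⊆⊕⊖Y : Y ⊆ ⊕ (⊖ Y)
    Y⊆⊕⊖Y {b} = subst Y (sym (prev-next b))

  closed-contains-agreeing : ∀ {Y} → Y ⊆ η Y → ∀ k {a b} →
    Y a → M (next^ k b) → cur (next^ k a) ≡ cur (next^ k b) → Y b
  closed-contains-agreeing Y-closed zero y mb a≡b = proj₂ (ρ∀⊑η _ (Y-closed y)) _ mb (sym a≡b)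
  closed-contains-agreeing {Y} Y-closed (suc k) {a} {b} y mb agree =
    subst Y (prev-next b)
      (closed-contains-agreeing (⊖-closed Y-closed) k (subst Y (sym (prev-next a)) y) mb agree)

module _ {𝕊 : Set} (_⟶_ : 𝕊 → 𝕊 → Set) (S : Pred 𝕊 0ℓ) where

  private
    M : TSet 𝕊
    M = 𝓜 _⟶_

  MeetAcross : Set
  MeetAcross = Σ ℕ λ k → (0 < k) × (Σ 𝕊 λ q → Σ 𝕊 λ r → Σ 𝕊 λ t →
                 S q × ¬ S r × Reach _⟶_ k q t × Reach _⟶_ k r t)

  Linked-preserves : ExcludedMiddle 0ℓ → ¬ MeetAcross → ∀ {q r} → S q → Linked _⟶_ q r → S r
  Linked-preserves em ¬meet Sq ε = Sq
  Linked-preserves em ¬meet Sq ((zero , _ , refl , r≡t) ◅ rest) =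
    Linked-preserves em ¬meet (subst S (sym r≡t) Sq) rest
  Linked-preserves em ¬meet {q} Sq (_◅_ {j = r} (suc k , t , q↝t , r↝t) rest) =
    let Sr = decidable-stable em λ ¬Sr → ¬meet (suc k , z<s , q , r , t , Sq , ¬Sr , q↝t , r↝t)
    in Linked-preserves em ¬meet Sr rest

  module _ {η : TSet 𝕊 → TSet 𝕊} (core : IsCore⊕ (ρ∀ M) η) where

    open IsCore⊕ core

    fixed-if-¬MeetAcross : ExcludedMiddle 0ℓ → IsTotal _⟶_ → ¬ MeetAcross → η (γ∀ M S) ≐ γ∀ M S
    fixed-if-¬MeetAcross em total ¬meet = IsUCO.reductive uco _ , λ (m , Sa) →
      least (linkedClosure _⟶_) (linkedClosure-isUCO _⟶_) (ρ∀⊑linkedClosure _⟶_)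
        (linkedClosure-complete _⟶_ total) (γ∀ M S)
        (m , λ b mb a~b → mb , Linked-preserves em ¬meet Sa a~b)

    ¬fixed-if-MeetAcross : IsTotal _⟶_ → MeetAcross → ¬ (η (γ∀ M S) ≐ γ∀ M S)
    ¬fixed-if-MeetAcross total (k , _ , _ , _ , _ , Sq , ¬Sr , q↝t , r↝t) (_ , γ⊆ηγ) =
      let _ , ma , a≡q , aₖ≡t = Reach⇒𝓜-trace _⟶_ total q↝t
          _ , mb , b≡r , bₖ≡t = Reach⇒𝓜-trace _⟶_ total r↝t
          γb = closed-contains-agreeing uco above complete γ⊆ηγ k
                 (ma , subst S (sym a≡q) Sq) (𝓜-next^ _⟶_ k mb) (trans aₖ≡t (sym bₖ≡t))
      in ¬Sr (subst S b≡r (proj₂ γb))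

theorem7 : ExcludedMiddle 0ℓ →
    (𝕊 : Set) (_⟶_ : 𝕊 → 𝕊 → Set) → IsTotal _⟶_ →
    (η : TSet 𝕊 → TSet 𝕊) → IsCore⊕ (ρ∀ (𝓜 _⟶_)) η →
    (S : Pred 𝕊 0ℓ) →
    (¬ (η (γ∀ (𝓜 _⟶_) S) ≐ γ∀ (𝓜 _⟶_) S))
      ⇔ (Σ ℕ λ k → (0 < k) × (Σ 𝕊 λ q → Σ 𝕊 λ r → Σ 𝕊 λ t →
           S q × ¬ S r × Reach _⟶_ k q t × Reach _⟶_ k r t))
theorem7 em 𝕊 _⟶_ total η core S = mk⇔
  (λ ¬fixed → decidable-stable em λ ¬meet → ¬fixed (fixed-if-¬MeetAcross _⟶_ S core em total ¬meet))
  (¬fixed-if-MeetAcross _⟶_ S core total)
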